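{- Let $T$ be the free model monad of an algebraic theory $\mathbb{T}=(\Sigma_{\mathbb{T}},E_{\mathbb{T}})$ such that $E_{\mathbb{T}}$ contains no drop equations. Then parallel lifting defines a distributive law of monads $T_{\mathsf{sd}}D_{\mathsf{sd}}\to D_{\mathsf{sd}}T_{\mathsf{sd}}$ on the category of setoids.
   Context: An equation $s=t$ is a drop equation if $s$ and $t$ do not have the same set of variables. $D$ is the coinductive delay monad: $DX\simeq X+DX$ final coalgebra with $\mathsf{now}$, $\mathsf{step}$ (in Clocked Cubical Type Theory $DX=\forall\kappa.D^\kappa X$). For a relation $R$ on $X$, weak bisimilarity $\approx_R$ on $DX$ is defined coinductively: $\mathsf{now}(x)\approx_R y$ iff $y=\mathsf{step}^n(\mathsf{now}\,y')$ for some $n\in\mathbb{N}$ and $y'$ with $R(x,y')$; $x\approx_R\mathsf{now}(y)$ iff $x=\mathsf{step}^n(\mathsf{now}\,x')$ with $R(x',y)$; $\mathsf{step}(x)\approx_R\mathsf{step}(y)$ iff $x\approx_R y$. The category of setoids has objects $(X,R)$ with $R$ an equivalence relation on the set $X$, and morphisms equivalence classes of relation-preserving maps, two maps being equivalent if they send related inputs to related outputs. $D_{\mathsf{sd}}(X,R)=(DX,\approx_R)$ is a monad on setoids (with the unit and multiplication of $D$). $T_{\mathsf{sd}}(X,R)=(TX,T(R))$ where $T(R)$ is the smallest equivalence relation relating $[t(x_1,\dots,x_n)]$ and $[t(y_1,\dots,y_n)]$ whenever $R(x_i,y_i)$ for all $i$. For a $T$-model $X$ and $n$-ary operation $\diamond$,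 the parallel lifting $\diamond^{\mathsf{par}}$ on $DX$ is defined corecursively: $\diamond^{\mathsf{par}}(\mathsf{now}\,x_1,\dots,\mathsf{now}\,x_n)=\mathsf{now}(\diamond_X(x_1,\dots,x_n))$, and if some argument is a $\mathsf{step}$, $\diamond^{\mathsf{par}}(x_1,\dots,x_n)=\mathsf{step}(\diamond^{\mathsf{par}}(x_1',\dots,x_n'))$ with $x_i'=x_i$ if $x_i=\mathsf{now}(\cdot)$ and $x_i'=z$ if $x_i=\mathsf{step}(z)$. For theories with no drop equations these liftings satisfy the equations, making $D(TX)$ a $T$-model, and the induced natural transformation $TDX\to DTX$ is the unique $T$-homomorphism extending $D\eta^T:DX\to DTX$. A distributive law $\zeta:ST\to TS$ of monads satisfies $\zeta\circ\eta^S T=T\eta^S$, $\zeta\circ S\eta^T=\eta^T S$, $\zeta\circ\mu^S T=T\mu^S\circ\zeta S\circ S\zeta$, $\zeta\circ S\mu^T=\mu^T S\circ T\zeta\circ\zeta T$. -}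

module Defs where

open import Level using (Level; 0ℓ) renaming (suc to lsuc; _⊔_ to _⊔ℓ_)
open import Data.Nat using (ℕ; zero; suc)
open import Data.Fin using (Fin; zero; suc)
open import Data.Maybe using (Maybe; just; nothing)
open import Data.Vec.Functional using () renaming (_∷_ to _∷ᶠ_)
open import Data.Product using (Σ; Σ-syntax; _×_; _,_)
open import Data.Sum using (_⊎_)
open import Data.Empty using (⊥)
open import Relation.Binary.PropositionalEquality using (_≡_; refl; sym; trans; cong)
open import Relation.Nullary using (¬_)
open import Relation.Binary using (Rel; REL; Setoid)

record Signature : Set₁ where
  field
    Op    : Set
    arity : Op → ℕ

module _ (Sig : Signature) where
  open Signature Sig

  data Term (V : Set) : Set where
    var : V → Term V
    op  : (o : Op) → (Fin (arity o) → Term V) → Term V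

record Theory : Set₁ where
  field
    sig   : Signature
    Eqn   : Set
    nvars : Eqn → ℕ
    lhs   : (e : Eqn) → Term sig (Fin (nvars e))
    rhs   : (e : Eqn) → Term sig (Fin (nvars e))
  open Signature sig public

module Terms {Sig : Signature} where
  open Signature Sig

  data _occursIn_ {V : Set} (x : V) : Term Sig V → Set where
    here  : x occursIn var x
    there : ∀ {o ts} (i : Fin (arity o)) → x occursIn ts i → x occursIn op o ts

  mapT : {A B : Set} → (A → B) → Term Sig A → Term Sig B
  mapT f (var a)   = var (f a)
  mapT f (op o ts) = op o (λ i → mapT f (ts i))

  _[_] : {A B : Set} → Term Sig A → (A → Term Sig B) → Term Sig B
  var a   [ σ ] = σ a
  op o ts [ σ ] = op o (λ i → ts i [ σ ])

  flatten : {A : Set} → Term Sig (Term Sig A) → Term Sig A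
  flatten t = t [ (λ u → u) ]

open Terms public

module _ (𝕋 : Theory) where
  open Theory 𝕋

  SameVariables : Eqn → Set
  SameVariables e = ∀ (x : Fin (nvars e)) →
    (x occursIn lhs e → x occursIn rhs e) × (x occursIn rhs e → x occursIn lhs e)

  IsDropEquation : Eqn → Set
  IsDropEquation e = ¬ SameVariables e

  NoDropEquations : Set
  NoDropEquations = ∀ (e : Eqn) → ¬ IsDropEquation e

  -- T(R): the relation of the setoid T_sd(X,R) = (TX, T(R)), presented on
  -- raw terms: the least congruence containing the instances of the
  -- equations of E and relating var x, var y whenever R x y.
  data TRel {ℓ} {X : Set} (R : Rel X ℓ) : Rel (Term sig X) ℓ where
    t-var   : ∀ {x y} → R x y → TRel R (var x) (var y)
    t-op    : ∀ o {ss ts} → (∀ i → TRel R (ss i) (ts i)) → TRel R (op o ss) (op o ts)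
    t-ax    : ∀ e (σ : Fin (nvars e) → Term sig X) → TRel R (lhs e [ σ ]) (rhs e [ σ ])
    t-refl  : ∀ {s} → TRel R s s
    t-sym   : ∀ {s t} → TRel R s t → TRel R t s
    t-trans : ∀ {s t u} → TRel R s t → TRel R t u → TRel R s u

-- The delay monad D, without coinductive types.
--
-- (--guardedness is not available.)  D A is presented as the limit of its
-- terminal sequence: a delayed computation is given by its observations
-- `seq k`, which is `just a` iff the computation is of the form
-- step^m (now a) with m ≤ k; monotonicity says that once it has
-- terminated it stays terminated with the same value.  This is (up to
-- function extensionality) the final coalgebra D A ≃ A + D A.

record Delay (A : Set) : Set where
  field
    seq  : ℕ → Maybe A
    mono : ∀ k {a} → seq k ≡ just a → seq (suc k) ≡ just a
open Delay public

now : {A : Set} → A → Delay A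
seq  (now a) k   = just a
mono (now a) k e = e

step : {A : Set} → Delay A → Delay A
seq  (step d) zero    = nothing
seq  (step d) (suc k) = seq d k
mono (step d) zero    ()
mono (step d) (suc k) e = mono d k e

-- the coalgebra structure  D A → A + D A
IsNow : {A : Set} → Delay A → A → Set
IsNow d a = seq d 0 ≡ just a

IsStep : {A : Set} → Delay A → Set
IsStep d = seq d 0 ≡ nothing

tail : {A : Set} → Delay A → Delay A
seq  (tail d) k = seq d (suc k)
mono (tail d) k = mono d (suc k)

_⇓_ : {A : Set} → Delay A → A → Set
d ⇓ a = Σ[ n ∈ ℕ ] seq d n ≡ just a

mapD : {A B : Set} → (A → B) → Delay A → Delay B
seq  (mapD f d) k = Data.Maybe.map f (seq d k)
  where import Data.Maybe
mono (mapD f d) k e with seq d k in eq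
... | just a with refl ← e = Relation.Binary.PropositionalEquality.cong (Data.Maybe.map f) (mono d k eq)
  where import Data.Maybe ; import Relation.Binary.PropositionalEquality
... | nothing with () ← e

-- multiplication: join (now d) = d, join (step dd) = step (join dd)
joinSeq : {A : Set} → (ℕ → Maybe (Delay A)) → ℕ → Maybe A
joinSeq s k with s 0
joinSeq s k       | just d  = seq d k
joinSeq s zero    | nothing = nothing
joinSeq s (suc k) | nothing = joinSeq (λ n → s (suc n)) k

joinSeq-mono : {A : Set} (s : ℕ → Maybe (Delay A)) →
  ∀ k {a} → joinSeq s k ≡ just a → joinSeq s (suc k) ≡ just a
joinSeq-mono s k e with s 0
joinSeq-mono s k       e | just d  = mono d k e
joinSeq-mono s zero    () | nothing
joinSeq-mono s (suc k) e | nothing = joinSeq-mono (λ n → s (suc n)) k e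

joinD : {A : Set} → Delay (Delay A) → Delay A
seq  (joinD dd) = joinSeq (seq dd)
mono (joinD dd) = joinSeq-mono (seq dd)

-- Weak bisimilarity ≈_R, defined coinductively as the greatest fixed
-- point (union of all post-fixed points) of the defining clauses:
--   now x ≈_R y       iff  y = step^n (now y') with R x y'
--   x ≈_R now y       iff  x = step^n (now x') with R x' y
--   step x ≈_R step y iff  x ≈_R y

WBClauses : ∀ {ℓ} {X : Set} (R : Rel X ℓ) (Q : Rel (Delay X) ℓ) → Rel (Delay X) ℓ
WBClauses R Q x y =
    (Σ[ a ∈ _ ] IsNow x a × Σ[ b ∈ _ ] (y ⇓ b × R a b))
  ⊎ (Σ[ b ∈ _ ] IsNow y b × Σ[ a ∈ _ ] (x ⇓ a × R a b))
  ⊎ (IsStep x × IsStep y × Q (tail x) (tail y))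

WB : ∀ {ℓ} {X : Set} (R : Rel X ℓ) → Rel (Delay X) (lsuc ℓ)
WB {ℓ} {X} R x y =
  Σ[ Q ∈ Rel (Delay X) ℓ ] ((∀ {x' y'} → Q x' y' → WBClauses R Q x' y') × Q x y)

allJust : {n : ℕ} {A : Set} → (Fin n → Maybe A) → Maybe (Fin n → A)
allJust {zero}  ms = just (λ ())
allJust {suc n} ms with ms zero | allJust (λ i → ms (suc i))
... | just a  | just as = just (a ∷ᶠ as)
... | just a  | nothing = nothing
... | nothing | _       = nothing

allJust-mono : {n : ℕ} {A : Set} (ms ms' : Fin n → Maybe A) →
  (∀ i {a} → ms i ≡ just a → ms' i ≡ just a) →
  ∀ {as} → allJust ms ≡ just as → allJust ms' ≡ just as
allJust-mono {zero} ms ms' h refl = refl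
allJust-mono {suc n} ms ms' h e with ms zero in e0 | allJust (λ i → ms (suc i)) in e1
allJust-mono {suc n} ms ms' h refl | just a | just as
  with ms' zero | h zero e0 | allJust (λ i → ms' (suc i))
     | allJust-mono (λ i → ms (suc i)) (λ i → ms' (suc i)) (λ i → h (suc i)) e1
... | just .a | refl | just .as | refl = refl

-- This is the unique solution of
-- the corecursive equations
--   par f (now x₁,…,now xₙ) = now (f (x₁,…,xₙ))
--   par f (x₁,…,xₙ)         = step (par f (x₁',…,xₙ'))   if some xᵢ is a step
-- (xᵢ' = xᵢ if xᵢ = now(_), xᵢ' = z if xᵢ = step z).
par : {n : ℕ} {A B : Set} → ((Fin n → A) → B) → (Fin n → Delay A) → Delay B
seq  (par f ds) k = Data.Maybe.map f (allJust (λ i → seq (ds i) k))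
  where import Data.Maybe
mono (par f ds) k e with allJust (λ i → seq (ds i) k) in eq
... | just as with refl ← e =
  Relation.Binary.PropositionalEquality.cong (Data.Maybe.map f)
    (allJust-mono _ _ (λ i → mono (ds i) k) eq)
  where import Data.Maybe ; import Relation.Binary.PropositionalEquality
... | nothing with () ← e

module _ (𝕋 : Theory) where
  open Theory 𝕋

  -- The natural transformation ζ : T D X → D T X induced by parallel
  -- lifting: the T-homomorphism from the free model T(DX) to D(TX)
  -- (equipped with the parallel liftings of the operations of the free
  -- model TX) extending D η^T = mapD var.
  ζ : {X : Set} → Term sig (Delay X) → Delay (Term sig X)
  ζ (var d)   = mapD var d
  ζ (op o ts) = par (op o) (λ i → ζ (ts i))

  -- A morphism (X,R) → (Y,R') is a relation-preserving
  -- map, and two morphisms f, g are equal iff R a b → R' (f a) (g b).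
  -- Recall T_sd(X,R) = (Term X, TRel R) (terms modulo E presented on raw
  -- terms), D_sd(X,R) = (Delay X, WB R); units/multiplications are
  -- var / flatten (T) and now / joinD (D); functor actions mapT / mapD.
  record IsDistributiveLawSd : Set₂ where
    field
      ζ-morphism : (S : Setoid 0ℓ 0ℓ) → let open Setoid S in
        ∀ {s t} → TRel 𝕋 (WB _≈_) s t → WB (TRel 𝕋 _≈_) (ζ s) (ζ t)
      ζ-natural : (S S' : Setoid 0ℓ 0ℓ) →
        (f : Setoid.Carrier S → Setoid.Carrier S') →
        (∀ {x y} → Setoid._≈_ S x y → Setoid._≈_ S' (f x) (f y)) →
        ∀ {s t} → TRel 𝕋 (WB (Setoid._≈_ S)) s t →
        WB (TRel 𝕋 (Setoid._≈_ S')) (mapD (mapT f) (ζ s)) (ζ (mapT (mapD f) t))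
      ζ-unit-T : (S : Setoid 0ℓ 0ℓ) → let open Setoid S in
        ∀ {d d'} → WB _≈_ d d' → WB (TRel 𝕋 _≈_) (ζ (var d)) (mapD var d')
      ζ-unit-D : (S : Setoid 0ℓ 0ℓ) → let open Setoid S in
        ∀ {s t} → TRel 𝕋 _≈_ s t → WB (TRel 𝕋 _≈_) (ζ (mapT now s)) (now t)
      ζ-mult-T : (S : Setoid 0ℓ 0ℓ) → let open Setoid S in
        ∀ {s t} → TRel 𝕋 (TRel 𝕋 (WB _≈_)) s t →
        WB (TRel 𝕋 _≈_) (ζ (flatten s)) (mapD flatten (ζ (mapT ζ t)))
      ζ-mult-D : (S : Setoid 0ℓ 0ℓ) → let open Setoid S in
        ∀ {s t} → TRel 𝕋 (WB (WB _≈_)) s t →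
        WB (TRel 𝕋 _≈_) (ζ (mapT joinD s)) (joinD (mapD ζ (ζ t)))

-- Weak bisimilarity ≈_R coincides with Equiconv R: every value of either side is R-related to
-- a value of the other.  Read this way, ζ t converges exactly when all delays at the leaves of t
-- do, and then to the term of their values (up to the pointwise equality ≐ of terms).  Each monad
-- law thus reduces to an identity between terms of values.  ζ respects an instance l [ σ ] = r [ σ ]
-- of an equation because l [ σ ] converges exactly when σ x does for the variables x of l, and
-- without drop equations these are the variables of r.

module Submission where

open import Level using (Level)
open import Function using (id; _∘_; flip)
open import Data.Nat using (ℕ; zero; suc; _≤_; z≤n; s≤s; _⊔_)
open import Data.Nat.Properties using (m≤m⊔n; m≤n⊔m; ≤-total)
open import Data.Fin using (Fin; zero; suc)
open import Data.Maybe using (Maybe; just; nothing; fromMaybe)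
import Data.Maybe as Maybe
open import Data.Maybe.Properties using (just-injective)
open import Data.Vec.Functional using () renaming (_∷_ to _∷ᶠ_)
open import Data.Product using (∃; ∃-syntax; _×_; _,_; proj₁; proj₂)
open import Data.Sum using (inj₁; inj₂)
open import Data.Empty using (⊥-elim)
open import Relation.Nullary using (¬_)
open import Relation.Binary using (Rel; REL; _⇒_)
open import Relation.Binary.PropositionalEquality using (_≡_; refl; sym; trans; cong; subst; _≗_)
open import Defs

private
  variable
    ℓ ℓ₁ ℓ₂ ℓ₃ : Level
    A B C D V : Set

-- Convergence

seq-mono : (d : Delay A) {a : A} {m n : ℕ} → m ≤ n → seq d m ≡ just a → seq d n ≡ just a
seq-mono d {n = zero}  z≤n     e = e
seq-mono d {n = suc n} z≤n     e = mono d n (seq-mono d z≤n e)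
seq-mono d             (s≤s p) e = seq-mono (tail d) p e

⇓-functional : (d : Delay A) {a b : A} → d ⇓ a → d ⇓ b → a ≡ b
⇓-functional d (m , e) (n , e') with ≤-total m n
... | inj₁ m≤n = just-injective (trans (sym (seq-mono d m≤n e)) e')
... | inj₂ n≤m = just-injective (trans (sym e) (seq-mono d n≤m e'))

now⇓ : {a : A} → now a ⇓ a
now⇓ = 0 , refl

now⇓⁻ : {a b : A} → now a ⇓ b → a ≡ b
now⇓⁻ (_ , e) = just-injective e

mapD⇓⁺ : (f : A → B) (d : Delay A) {a : A} → d ⇓ a → mapD f d ⇓ f a
mapD⇓⁺ f d (n , e) = n , cong (Maybe.map f) e

mapD⇓⁻ : (f : A → B) (d : Delay A) {b : B} → mapD f d ⇓ b → ∃[ a ] (d ⇓ a × f a ≡ b)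
mapD⇓⁻ f d (n , e) with seq d n in eq
mapD⇓⁻ f d (n , e)  | just a  = a , (n , eq) , just-injective e
mapD⇓⁻ f d (n , ()) | nothing

joinSeq⇓⁻ : (s : ℕ → Maybe (Delay A)) (k : ℕ) {a : A} → joinSeq s k ≡ just a →
  ∃[ m ] ∃[ d ] (s m ≡ just d × d ⇓ a)
joinSeq⇓⁻ s k e with s 0 in e₀
joinSeq⇓⁻ s k       e  | just d  = 0 , d , e₀ , (k , e)
joinSeq⇓⁻ s zero    () | nothing
joinSeq⇓⁻ s (suc k) e  | nothing =
  let m , d , e' , d⇓a = joinSeq⇓⁻ (s ∘ suc) k e in suc m , d , e' , d⇓a

joinD⇓⁺ : (dd : Delay (Delay A)) {d : Delay A} {a : A} → dd ⇓ d → d ⇓ a → joinD dd ⇓ a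
joinD⇓⁺ dd (m , e) = from dd m e
  where
  from : ∀ {d a} (dd : Delay (Delay A)) (m : ℕ) → seq dd m ≡ just d → d ⇓ a → joinD dd ⇓ a
  from {a = a} dd m e (j , e') with seq dd 0 in e₀
  ... | just d' = j , subst (λ d → seq d j ≡ just a) (⇓-functional dd (m , e) (0 , e₀)) e'
  from dd zero    e _   | nothing with () ← trans (sym e₀) e
  from dd (suc m) e d⇓a | nothing = let k , e'' = from (tail dd) m e d⇓a in suc k , e''

joinD⇓⁻ : (dd : Delay (Delay A)) {a : A} → joinD dd ⇓ a → ∃[ d ] (dd ⇓ d × d ⇓ a)
joinD⇓⁻ dd (k , e) = let m , d , e' , d⇓a = joinSeq⇓⁻ (seq dd) k e in d , (m , e') , d⇓a

allJust⁻ : {n : ℕ} (ms : Fin n → Maybe A) {as : Fin n → A} → allJust ms ≡ just as → ∀ i → ms i ≡ just (as i)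
allJust⁻ {n = suc n} ms e with ms zero in e₀ | allJust (ms ∘ suc) in e₁
allJust⁻ {n = suc n} ms refl | just a  | just as = λ { zero → e₀ ; (suc i) → allJust⁻ (ms ∘ suc) e₁ i }
allJust⁻ {n = suc n} ms ()   | just a  | nothing
allJust⁻ {n = suc n} ms ()   | nothing | _

allJust⁺ : {n : ℕ} (ms : Fin n → Maybe A) {bs : Fin n → A} → (∀ i → ms i ≡ just (bs i)) →
  ∃[ as ] (allJust ms ≡ just as × as ≗ bs)
allJust⁺ {n = zero} ms h = (λ ()) , refl , (λ ())
allJust⁺ {n = suc n} ms {bs} h
  with ms zero | h zero | allJust (ms ∘ suc) | allJust⁺ (ms ∘ suc) (h ∘ suc)
... | just _ | refl | just _ | as , refl , as≗bs =
  (bs zero ∷ᶠ as) , refl , λ { zero → refl ; (suc i) → as≗bs i }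

common-witness : {n : ℕ} (P : Fin n → ℕ → Set ℓ) → (∀ i {k k'} → k ≤ k' → P i k → P i k') →
  (∀ i → ∃ (P i)) → ∃[ N ] ∀ i → P i N
common-witness {n = zero}  P up h = 0 , λ ()
common-witness {n = suc n} P up h =
  let k , p = h zero ; K , ps = common-witness (P ∘ suc) (up ∘ suc) (h ∘ suc) in
  k ⊔ K , λ { zero → up zero (m≤m⊔n k K) p ; (suc i) → up (suc i) (m≤n⊔m k K) (ps i) }

par-seq⁻ : {n : ℕ} (f : (Fin n → A) → B) (ds : Fin n → Delay A) (k : ℕ) {b : B} →
  seq (par f ds) k ≡ just b → ∃[ as ] ((∀ i → seq (ds i) k ≡ just (as i)) × f as ≡ b)
par-seq⁻ f ds k e with allJust (λ i → seq (ds i) k) in eq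
par-seq⁻ f ds k e  | just as = as , allJust⁻ _ eq , just-injective e
par-seq⁻ f ds k () | nothing

par⇓⁻ : {n : ℕ} (f : (Fin n → A) → B) (ds : Fin n → Delay A) {b : B} →
  par f ds ⇓ b → ∃[ as ] ((∀ i → ds i ⇓ as i) × f as ≡ b)
par⇓⁻ f ds (k , e) = let as , e' , fas≡b = par-seq⁻ f ds k e in as , (λ i → k , e' i) , fas≡b

-- par f ds converges at any time by which all arguments have; allJust rebuilds the vector of
-- values, which therefore agrees with bs only pointwise.
par⇓⁺ : {n : ℕ} (f : (Fin n → A) → B) (ds : Fin n → Delay A) {bs : Fin n → A} →
  (∀ i → ds i ⇓ bs i) → ∃[ as ] (par f ds ⇓ f as × as ≗ bs)
par⇓⁺ f ds {bs} h =
  let N , e = common-witness (λ i k → seq (ds i) k ≡ just (bs i)) (λ i → seq-mono (ds i)) h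
      as , e' , as≗bs = allJust⁺ (λ i → seq (ds i) N) e in
  as , (N , cong (Maybe.map f) e') , as≗bs

-- Weak bisimilarity through values

record Sim {A B : Set} (R : REL A B ℓ) (x : Delay A) (y : Delay B) : Set ℓ where
  constructor sim
  field
    simulate : ∀ {a} → x ⇓ a → ∃[ b ] (y ⇓ b × R a b)
open Sim public

module _ {R : REL A B ℓ₁} where

  Sim-mono : {S : REL A B ℓ₂} {x : Delay A} {y : Delay B} → R ⇒ S → Sim R x y → Sim S x y
  Sim-mono R⇒S s = sim λ p → let b , q , r = simulate s p in b , q , R⇒S r

  Sim-trans : {S : REL B C ℓ₂} {T : REL A C ℓ₃} {x : Delay A} {y : Delay B} {z : Delay C} →
    (∀ {a b c} → R a b → S b c → T a c) → Sim R x y → Sim S y z → Sim T x z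
  Sim-trans h s s' = sim λ p →
    let b , q , r = simulate s p ; c , q' , r' = simulate s' q in c , q' , h r r'

  Sim-mapD : {S : REL C D ℓ₂} {f : A → C} {g : B → D} {x : Delay A} {y : Delay B} →
    (∀ {a b} → R a b → S (f a) (g b)) → Sim R x y → Sim S (mapD f x) (mapD g y)
  Sim-mapD {S = S} {f} {g} {x} {y} h s = sim λ p →
    let a , x⇓a , fa≡c = mapD⇓⁻ f x p ; b , y⇓b , r = simulate s x⇓a in
    g b , mapD⇓⁺ g y y⇓b , subst (λ c → S c (g b)) fa≡c (h r)

  Sim-now : {a : A} {b : B} → R a b → Sim R (now a) (now b)
  Sim-now {b = b} r = sim λ p → b , now⇓ , subst (λ a → R a b) (now⇓⁻ p) r

  Sim-joinD : {dd : Delay (Delay A)} {ee : Delay (Delay B)} → Sim (Sim R) dd ee → Sim R (joinD dd) (joinD ee)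
  Sim-joinD {dd = dd} {ee} s = sim λ p →
    let d , dd⇓d , d⇓a = joinD⇓⁻ dd p ; e , ee⇓e , d∼e = simulate s dd⇓d ; b , e⇓b , r = simulate d∼e d⇓a in
    b , joinD⇓⁺ ee ee⇓e e⇓b , r

  Sim-par : {n : ℕ} {S : REL C D ℓ₂} (f : (Fin n → A) → C) (g : (Fin n → B) → D)
    (ds : Fin n → Delay A) (es : Fin n → Delay B) →
    (∀ {as bs} → (∀ i → R (as i) (bs i)) → S (f as) (g bs)) →
    (∀ i → Sim R (ds i) (es i)) → Sim S (par f ds) (par g es)
  Sim-par {S = S} f g ds es h s = sim λ p →
    let as , ds⇓as , fas≡c = par⇓⁻ f ds p
        matched = λ i → simulate (s i) (ds⇓as i)
        bs , par⇓gbs , bs≗ = par⇓⁺ g es (λ i → proj₁ (proj₂ (matched i)))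
        related = λ i → subst (R (as i)) (sym (bs≗ i)) (proj₂ (proj₂ (matched i)))
    in g bs , par⇓gbs , subst (λ c → S c (g bs)) fas≡c (h related)

  Sim-tail : {x : Delay A} {y : Delay B} → IsStep y → Sim R x y → Sim R (tail x) (tail y)
  Sim-tail {x = x} {y} y-step s = sim tail⇓
    where
    tail⇓ : ∀ {a} → tail x ⇓ a → ∃[ b ] (tail y ⇓ b × R a b)
    tail⇓ (n , e) with simulate s (suc n , e)
    ... | b , (zero , e') , r with () ← trans (sym y-step) e'
    ... | b , (suc j , e') , r = b , (j , e') , r

record Equiconv {A B : Set} (R : REL A B ℓ) (x : Delay A) (y : Delay B) : Set ℓ where
  field
    forth : Sim R x y
    back  : Sim (flip R) y x
open Equiconv public

module _ {R : REL A B ℓ₁} where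

  Equiconv-mono : {S : REL A B ℓ₂} {x : Delay A} {y : Delay B} → R ⇒ S → Equiconv R x y → Equiconv S x y
  Equiconv-mono R⇒S e = record { forth = Sim-mono R⇒S (forth e) ; back = Sim-mono R⇒S (back e) }

  Equiconv-sym : {S : REL B A ℓ₂} {x : Delay A} {y : Delay B} →
    (∀ {a b} → R a b → S b a) → Equiconv R x y → Equiconv S y x
  Equiconv-sym h e = record { forth = Sim-mono h (back e) ; back = Sim-mono h (forth e) }

  Equiconv-trans : {S : REL B C ℓ₂} {T : REL A C ℓ₃} {x : Delay A} {y : Delay B} {z : Delay C} →
    (∀ {a b c} → R a b → S b c → T a c) → Equiconv R x y → Equiconv S y z → Equiconv T x z
  Equiconv-trans h e e' = record
    { forth = Sim-trans h (forth e) (forth e')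
    ; back  = Sim-trans (λ s r → h r s) (back e') (back e)
    }

  Equiconv-mapD : {S : REL C D ℓ₂} {f : A → C} {g : B → D} {x : Delay A} {y : Delay B} →
    (∀ {a b} → R a b → S (f a) (g b)) → Equiconv R x y → Equiconv S (mapD f x) (mapD g y)
  Equiconv-mapD h e = record { forth = Sim-mapD h (forth e) ; back = Sim-mapD h (back e) }

  Equiconv-joinD : {dd : Delay (Delay A)} {ee : Delay (Delay B)} →
    Equiconv (Equiconv R) dd ee → Equiconv R (joinD dd) (joinD ee)
  Equiconv-joinD e = record
    { forth = Sim-joinD (Sim-mono forth (forth e))
    ; back  = Sim-joinD (Sim-mono back (back e))
    }

  Equiconv-par : {n : ℕ} {S : REL C D ℓ₂} (f : (Fin n → A) → C) (g : (Fin n → B) → D)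
    (ds : Fin n → Delay A) (es : Fin n → Delay B) →
    (∀ {as bs} → (∀ i → R (as i) (bs i)) → S (f as) (g bs)) →
    (∀ i → Equiconv R (ds i) (es i)) → Equiconv S (par f ds) (par g es)
  Equiconv-par f g ds es h e = record
    { forth = Sim-par f g ds es h (forth ∘ e)
    ; back  = Sim-par g f es ds h (back ∘ e)
    }

Equiconv-refl : {R : Rel A ℓ} {x : Delay A} → (∀ {a} → R a a) → Equiconv R x x
Equiconv-refl r = record { forth = sim λ p → _ , p , r ; back = sim λ p → _ , p , r }

Equiconv-now : {R : REL A B ℓ} {a : A} {b : B} → R a b → Equiconv R (now a) (now b)
Equiconv-now r = record { forth = Sim-now r ; back = Sim-now r }

module _ {X : Set} where

  WBClauses-flip : {R : Rel X ℓ} {Q : Rel (Delay X) ℓ} {x y : Delay X} →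
    WBClauses R Q x y → WBClauses (flip R) (flip Q) y x
  WBClauses-flip (inj₁ c)                     = inj₂ (inj₁ c)
  WBClauses-flip (inj₂ (inj₁ c))              = inj₁ c
  WBClauses-flip (inj₂ (inj₂ (sx , sy , q))) = inj₂ (inj₂ (sy , sx , q))

  WB-flip : {R : Rel X ℓ} {x y : Delay X} → WB R x y → WB (flip R) y x
  WB-flip {R = R} (Q , post , q) = flip Q , (λ {y'} {x'} q' → WBClauses-flip {R = R} {Q} {x'} {y'} (post q')) , q

  postfixed⇒Sim : {R : Rel X ℓ} {Q : Rel (Delay X) ℓ} → (∀ {x y} → Q x y → WBClauses R Q x y) →
    ∀ {x y} → Q x y → Sim R x y
  postfixed⇒Sim {R = R} {Q} post q = sim λ (n , e) → at n q e
    where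
    at : ∀ n {x y a} → Q x y → seq x n ≡ just a → ∃[ b ] (y ⇓ b × R a b)
    at n {x} q e with post q
    ... | inj₁ (a' , x≡a' , b , y⇓b , r) =
      b , y⇓b , subst (λ a → R a b) (⇓-functional x (0 , x≡a') (n , e)) r
    ... | inj₂ (inj₁ (b , y≡b , a' , x⇓a' , r)) =
      b , (0 , y≡b) , subst (λ a → R a b) (⇓-functional x x⇓a' (n , e)) r
    at zero    q e | inj₂ (inj₂ (x-step , _ , _)) with () ← trans (sym x-step) e
    at (suc n) q e | inj₂ (inj₂ (_ , _ , q')) = let b , (j , e') , r = at n q' e in b , (suc j , e') , r

  WB⇒Equiconv : {R : Rel X ℓ} {x y : Delay X} → WB R x y → Equiconv R x y
  WB⇒Equiconv w = record { forth = WB⇒Sim w ; back = WB⇒Sim (WB-flip w) }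
    where
    WB⇒Sim : ∀ {R : Rel X ℓ} {x y} → WB R x y → Sim R x y
    WB⇒Sim (Q , post , q) = postfixed⇒Sim {Q = Q} post q

  Equiconv-postfixed : {R : Rel X ℓ} {x y : Delay X} → Equiconv R x y → WBClauses R (Equiconv R) x y
  Equiconv-postfixed {x = x} {y} e with seq x 0 in x₀ | seq y 0 in y₀
  ... | just a  | _       = inj₁ (a , refl , simulate (forth e) (0 , x₀))
  ... | nothing | just b  = inj₂ (inj₁ (b , refl , simulate (back e) (0 , y₀)))
  ... | nothing | nothing = inj₂ (inj₂ (refl , refl , record
    { forth = Sim-tail y₀ (forth e) ; back = Sim-tail x₀ (back e) }))

  Equiconv⇒WB : {R : Rel X ℓ} {x y : Delay X} → Equiconv R x y → WB R x y
  Equiconv⇒WB {R = R} e = Equiconv R , Equiconv-postfixed , e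

WB-joinD : {R : Rel A ℓ} {dd ee : Delay (Delay A)} → WB (WB R) dd ee → WB R (joinD dd) (joinD ee)
WB-joinD w = Equiconv⇒WB (Equiconv-joinD (Equiconv-mono WB⇒Equiconv (WB⇒Equiconv w)))

-- Terms

module _ {Sig : Signature} where
  open Signature Sig

  data Pointwise {A B : Set} (R : REL A B ℓ) : Term Sig A → Term Sig B → Set ℓ where
    var : ∀ {a b} → R a b → Pointwise R (var a) (var b)
    op  : ∀ o {ss ts} → (∀ i → Pointwise R (ss i) (ts i)) → Pointwise R (op o ss) (op o ts)

  infix 4 _≐_
  _≐_ : Term Sig A → Term Sig A → Set
  _≐_ = Pointwise _≡_

  module _ {R : REL A B ℓ₁} where

    Pointwise-mono : {S : REL A B ℓ₂} → R ⇒ S → Pointwise R ⇒ Pointwise S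
    Pointwise-mono h (var r)   = var (h r)
    Pointwise-mono h (op o ps) = op o (λ i → Pointwise-mono h (ps i))

    Pointwise-sym : {S : REL B A ℓ₂} {s : Term Sig A} {t : Term Sig B} →
      (∀ {a b} → R a b → S b a) → Pointwise R s t → Pointwise S t s
    Pointwise-sym h (var r)   = var (h r)
    Pointwise-sym h (op o ps) = op o (λ i → Pointwise-sym h (ps i))

    Pointwise-trans : {S : REL B C ℓ₂} {T : REL A C ℓ₃} {s : Term Sig A} {t : Term Sig B} {u : Term Sig C} →
      (∀ {a b c} → R a b → S b c → T a c) → Pointwise R s t → Pointwise S t u → Pointwise T s u
    Pointwise-trans h (var r)   (var r')     = var (h r r')
    Pointwise-trans h (op o ps) (op .o ps') = op o (λ i → Pointwise-trans h (ps i) (ps' i))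

    Pointwise-functional : {s : Term Sig A} {t u : Term Sig B} →
      (∀ {a b c} → R a b → R a c → b ≡ c) → Pointwise R s t → Pointwise R s u → t ≐ u
    Pointwise-functional h (var r)   (var r')     = var (h r r')
    Pointwise-functional h (op o ps) (op .o ps') = op o (λ i → Pointwise-functional h (ps i) (ps' i))

    Pointwise-factor : {S : REL B C ℓ₂} {s : Term Sig A} {u : Term Sig C} →
      Pointwise (λ a c → ∃[ b ] (R a b × S b c)) s u → ∃[ v ] (Pointwise R s v × Pointwise S v u)
    Pointwise-factor (var (b , r , r')) = var b , var r , var r'
    Pointwise-factor (op o ps) =
      op o (proj₁ ∘ factors) , op o (proj₁ ∘ proj₂ ∘ factors) , op o (proj₂ ∘ proj₂ ∘ factors)
      where factors = λ i → Pointwise-factor (ps i)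

    Pointwise-mapT : {S : REL C D ℓ₂} {f : A → C} {g : B → D} {s : Term Sig A} {t : Term Sig B} →
      (∀ {a b} → R a b → S (f a) (g b)) → Pointwise R s t → Pointwise S (mapT f s) (mapT g t)
    Pointwise-mapT h (var r)   = var (h r)
    Pointwise-mapT h (op o ps) = op o (λ i → Pointwise-mapT h (ps i))

    Pointwise-subst : {S : REL C D ℓ₂} {σ : A → Term Sig C} {τ : B → Term Sig D} {s : Term Sig A} {t : Term Sig B} →
      (∀ {a b} → R a b → Pointwise S (σ a) (τ b)) → Pointwise R s t → Pointwise S (s [ σ ]) (t [ τ ])
    Pointwise-subst h (var r)   = h r
    Pointwise-subst h (op o ps) = op o (λ i → Pointwise-subst h (ps i))

    Pointwise-subst-occurring : (t : Term Sig V) {σ : V → Term Sig A} {τ : V → Term Sig B} →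
      (∀ x → x occursIn t → Pointwise R (σ x) (τ x)) → Pointwise R (t [ σ ]) (t [ τ ])
    Pointwise-subst-occurring (var x)   h = h x here
    Pointwise-subst-occurring (op o ts) h = op o (λ i → Pointwise-subst-occurring (ts i) (λ x → h x ∘ there i))

  module _ {R : REL C B ℓ} {f : A → C} where

    Pointwise-mapTˡ : {s : Term Sig A} {t : Term Sig B} → Pointwise (R ∘ f) s t → Pointwise R (mapT f s) t
    Pointwise-mapTˡ (var r)   = var r
    Pointwise-mapTˡ (op o ps) = op o (λ i → Pointwise-mapTˡ (ps i))

    Pointwise-mapTˡ⁻ : (s : Term Sig A) {t : Term Sig B} → Pointwise R (mapT f s) t → Pointwise (R ∘ f) s t
    Pointwise-mapTˡ⁻ (var a)   (var r)     = var r
    Pointwise-mapTˡ⁻ (op o ss) (op .o ps) = op o (λ i → Pointwise-mapTˡ⁻ (ss i) (ps i))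

  ≐-refl : (t : Term Sig A) → t ≐ t
  ≐-refl (var a)   = var refl
  ≐-refl (op o ts) = op o (λ i → ≐-refl (ts i))

  ≐-sym : {s t : Term Sig A} → s ≐ t → t ≐ s
  ≐-sym = Pointwise-sym sym

  ≐-trans : {s t u : Term Sig A} → s ≐ t → t ≐ u → s ≐ u
  ≐-trans = Pointwise-trans trans

  subst-assoc : (t : Term Sig V) (ρ : V → Term Sig A) (σ : A → Term Sig B) →
    ((t [ ρ ]) [ σ ]) ≐ (t [ (λ x → ρ x [ σ ]) ])
  subst-assoc (var x)   ρ σ = ≐-refl (ρ x [ σ ])
  subst-assoc (op o ts) ρ σ = op o (λ i → subst-assoc (ts i) ρ σ)

  mapT≐subst : (f : A → B) (t : Term Sig A) → mapT f t ≐ (t [ var ∘ f ])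
  mapT≐subst f (var a)   = var refl
  mapT≐subst f (op o ts) = op o (λ i → mapT≐subst f (ts i))

-- The parallel lifting ζ

module DistributiveLaw (𝕋 : Theory) where
  open Theory 𝕋

  ≐⇒TRel : {R : Rel A ℓ} {s t : Term sig A} → s ≐ t → TRel 𝕋 R s t
  ≐⇒TRel (var refl) = t-refl
  ≐⇒TRel (op o ps)  = t-op o (λ i → ≐⇒TRel (ps i))

  TRel-resp-≐ : {R : Rel A ℓ} {s s' t t' : Term sig A} → s ≐ s' → t ≐ t' → TRel 𝕋 R s t → TRel 𝕋 R s' t'
  TRel-resp-≐ s≐s' t≐t' r = t-trans (≐⇒TRel (≐-sym s≐s')) (t-trans r (≐⇒TRel t≐t'))

  TRel-subst : {R : Rel A ℓ₁} {S : Rel B ℓ₂} (σ : A → Term sig B) → (∀ {a b} → R a b → TRel 𝕋 S (σ a) (σ b)) →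
    ∀ {s t} → TRel 𝕋 R s t → TRel 𝕋 S (s [ σ ]) (t [ σ ])
  TRel-subst σ h (t-var r)     = h r
  TRel-subst σ h (t-op o ps)   = t-op o (λ i → TRel-subst σ h (ps i))
  TRel-subst σ h (t-ax e ρ)    =
    TRel-resp-≐ (≐-sym (subst-assoc (lhs e) ρ σ)) (≐-sym (subst-assoc (rhs e) ρ σ)) (t-ax e (λ x → ρ x [ σ ]))
  TRel-subst σ h t-refl        = t-refl
  TRel-subst σ h (t-sym p)     = t-sym (TRel-subst σ h p)
  TRel-subst σ h (t-trans p q) = t-trans (TRel-subst σ h p) (TRel-subst σ h q)

  TRel-mapT : {R : Rel A ℓ₁} {S : Rel B ℓ₂} (f : A → B) → (∀ {a b} → R a b → S (f a) (f b)) →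
    ∀ {s t} → TRel 𝕋 R s t → TRel 𝕋 S (mapT f s) (mapT f t)
  TRel-mapT f h {s} {t} p =
    TRel-resp-≐ (≐-sym (mapT≐subst f s)) (≐-sym (mapT≐subst f t)) (TRel-subst (var ∘ f) (λ r → t-var (h r)) p)

  infix 4 _⇓ᵀ_
  _⇓ᵀ_ : Term sig (Delay A) → Term sig A → Set
  _⇓ᵀ_ = Pointwise _⇓_

  ζ⇓⁻ : (t : Term sig (Delay A)) {u : Term sig A} → ζ 𝕋 t ⇓ u → t ⇓ᵀ u
  ζ⇓⁻ (var d) p with mapD⇓⁻ var d p
  ... | a , d⇓a , refl = var d⇓a
  ζ⇓⁻ (op o ts) p with par⇓⁻ (op o) (ζ 𝕋 ∘ ts) p
  ... | us , ts⇓us , refl = op o (λ i → ζ⇓⁻ (ts i) (ts⇓us i))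

  ζ⇓⁺ : {t : Term sig (Delay A)} {v : Term sig A} → t ⇓ᵀ v → ∃[ u ] (ζ 𝕋 t ⇓ u × u ≐ v)
  ζ⇓⁺ (var {d} d⇓a) = _ , mapD⇓⁺ var d d⇓a , var refl
  ζ⇓⁺ (op o {ts} ps) =
    let us , ζ⇓us , us≗ = par⇓⁺ (op o) (ζ 𝕋 ∘ ts) (λ i → proj₁ (proj₂ (ζ⇓⁺ (ps i)))) in
    op o us , ζ⇓us , op o (λ i → subst (_≐ _) (sym (us≗ i)) (proj₂ (proj₂ (ζ⇓⁺ (ps i)))))

  ζ-Equiconv-≐ : (t : Term sig (Delay A)) (y : Delay (Term sig A)) →
    (∀ {u} → t ⇓ᵀ u → ∃[ v ] (y ⇓ v × u ≐ v)) → (∀ {v} → y ⇓ v → ∃[ u ] (t ⇓ᵀ u × u ≐ v)) →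
    Equiconv _≐_ (ζ 𝕋 t) y
  ζ-Equiconv-≐ t y values→ ←values = record
    { forth = sim λ p → values→ (ζ⇓⁻ t p)
    ; back  = sim λ q → let u , t⇓u , u≐v = ←values q ; u' , p , u'≐u = ζ⇓⁺ t⇓u in u' , p , ≐-trans u'≐u u≐v
    }

  forced-variable : (t : Term sig V) (σ : V → Term sig (Delay A)) {k : ℕ} {u : Term sig A} {x : V} →
    seq (ζ 𝕋 (t [ σ ])) k ≡ just u → x occursIn t → ∃[ v ] seq (ζ 𝕋 (σ x)) k ≡ just v
  forced-variable (var x)   σ e here         = _ , e
  forced-variable (op o ts) σ {k} e (there i x∈t) =
    forced-variable (ts i) σ (proj₁ (proj₂ (par-seq⁻ (op o) (λ j → ζ 𝕋 (ts j [ σ ])) k e)) i) x∈t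

  -- The variables of r are known to occur in l only up to double negation, which suffices because
  -- it is decidable whether σ x has converged by the time N at which l [ σ ] has.  w x is the value
  -- of σ x at time N, with the junk default u where σ x has not converged yet.
  ζ⇓-instance : {m : ℕ} (l r : Term sig (Fin m)) → (∀ x → x occursIn r → ¬ ¬ x occursIn l) →
    (σ : Fin m → Term sig (Delay A)) {u : Term sig A} → ζ 𝕋 (l [ σ ]) ⇓ u →
    ∃[ w ] ∃[ u' ] (ζ 𝕋 (r [ σ ]) ⇓ u' × u ≐ (l [ w ]) × u' ≐ (r [ w ]))
  ζ⇓-instance {A = A} l r r⊆l σ {u} (N , e) =
    let u' , ζr⇓u' , u'≐r[w] = ζ⇓⁺ r⇓ᵀ in
    w , u' , ζr⇓u' , Pointwise-functional (λ {d} → ⇓-functional d) (ζ⇓⁻ (l [ σ ]) (N , e)) l⇓ᵀ , u'≐r[w]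
    where
    w : Fin _ → Term sig A
    w x = fromMaybe u (seq (ζ 𝕋 (σ x)) N)

    converged : ∀ x {v} → seq (ζ 𝕋 (σ x)) N ≡ just v → σ x ⇓ᵀ w x
    converged x eq = subst (λ m → σ x ⇓ᵀ fromMaybe u m) (sym eq) (ζ⇓⁻ (σ x) (N , eq))

    not-converged : ∀ x → seq (ζ 𝕋 (σ x)) N ≡ nothing → ¬ x occursIn l
    not-converged x eq x∈l with () ← trans (sym eq) (proj₂ (forced-variable l σ e x∈l))

    occurring-in-r : ∀ x → x occursIn r → (m : Maybe (Term sig A)) → seq (ζ 𝕋 (σ x)) N ≡ m → σ x ⇓ᵀ w x
    occurring-in-r x _    (just v) eq = converged x eq
    occurring-in-r x x∈r nothing  eq = ⊥-elim (r⊆l x x∈r (not-converged x eq))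

    l⇓ᵀ : (l [ σ ]) ⇓ᵀ (l [ w ])
    l⇓ᵀ = Pointwise-subst-occurring l (λ x x∈l → converged x (proj₂ (forced-variable l σ e x∈l)))

    r⇓ᵀ : (r [ σ ]) ⇓ᵀ (r [ w ])
    r⇓ᵀ = Pointwise-subst-occurring r (λ x x∈r → occurring-in-r x x∈r _ refl)

  module _ (no-drop : NoDropEquations 𝕋) where

    Equiconv-axiom : {R : Rel A ℓ} (e : Eqn) (σ : Fin (nvars e) → Term sig (Delay A)) →
      Equiconv (TRel 𝕋 R) (ζ 𝕋 (lhs e [ σ ])) (ζ 𝕋 (rhs e [ σ ]))
    Equiconv-axiom e σ = record
      { forth = sim λ p →
          let w , u' , p' , u≐l[w] , u'≐r[w] = ζ⇓-instance (lhs e) (rhs e) rhs⊆lhs σ p in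
          u' , p' , TRel-resp-≐ (≐-sym u≐l[w]) (≐-sym u'≐r[w]) (t-ax e w)
      ; back = sim λ p →
          let w , u' , p' , u≐r[w] , u'≐l[w] = ζ⇓-instance (rhs e) (lhs e) lhs⊆rhs σ p in
          u' , p' , TRel-resp-≐ (≐-sym u'≐l[w]) (≐-sym u≐r[w]) (t-ax e w)
      }
      where
      rhs⊆lhs : ∀ x → x occursIn rhs e → ¬ ¬ x occursIn lhs e
      rhs⊆lhs x x∈r x∉l = no-drop e (λ same → x∉l (proj₂ (same x) x∈r))

      lhs⊆rhs : ∀ x → x occursIn lhs e → ¬ ¬ x occursIn rhs e
      lhs⊆rhs x x∈l x∉r = no-drop e (λ same → x∉r (proj₁ (same x) x∈l))

    ζ-cong : {P : Rel (Delay A) ℓ₁} {R : Rel A ℓ₂} → (∀ {d e} → P d e → Equiconv R d e) →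
      ∀ {s t} → TRel 𝕋 P s t → Equiconv (TRel 𝕋 R) (ζ 𝕋 s) (ζ 𝕋 t)
    ζ-cong P⇒R (t-var p)             = Equiconv-mapD t-var (P⇒R p)
    ζ-cong P⇒R (t-op o {ss} {ts} ps) =
      Equiconv-par (op o) (op o) (ζ 𝕋 ∘ ss) (ζ 𝕋 ∘ ts) (t-op o) (λ i → ζ-cong P⇒R (ps i))
    ζ-cong P⇒R (t-ax e σ)            = Equiconv-axiom e σ
    ζ-cong P⇒R t-refl                = Equiconv-refl t-refl
    ζ-cong P⇒R (t-sym p)             = Equiconv-sym t-sym (ζ-cong P⇒R p)
    ζ-cong P⇒R (t-trans p q)         = Equiconv-trans t-trans (ζ-cong P⇒R p) (ζ-cong P⇒R q)

    ζ-preserves-WB : {R : Rel A ℓ} {s t : Term sig (Delay A)} →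
      TRel 𝕋 (WB R) s t → Equiconv (TRel 𝕋 R) (ζ 𝕋 s) (ζ 𝕋 t)
    ζ-preserves-WB = ζ-cong WB⇒Equiconv

  TRel-flatten : {R : Rel A ℓ} {s t : Term sig (Term sig A)} → TRel 𝕋 (TRel 𝕋 R) s t → TRel 𝕋 R (flatten s) (flatten t)
  TRel-flatten = TRel-subst id id

  Equiconv-TRel-≐ : {R : Rel A ℓ} {x y z : Delay (Term sig A)} →
    Equiconv (TRel 𝕋 R) x y → Equiconv _≐_ y z → Equiconv (TRel 𝕋 R) x z
  Equiconv-TRel-≐ = Equiconv-trans (λ r q → t-trans r (≐⇒TRel q))

  ζ-natural-≐ : (f : A → B) (t : Term sig (Delay A)) → Equiconv _≐_ (mapD (mapT f) (ζ 𝕋 t)) (ζ 𝕋 (mapT (mapD f) t))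
  ζ-natural-≐ f t = Equiconv-sym ≐-sym (ζ-Equiconv-≐ (mapT (mapD f) t) (mapD (mapT f) (ζ 𝕋 t)) values→ ←values)
    where
    values→ : ∀ {u} → mapT (mapD f) t ⇓ᵀ u → ∃[ v ] (mapD (mapT f) (ζ 𝕋 t) ⇓ v × u ≐ v)
    values→ p =
      let v , t⇓v , fv≡u = Pointwise-factor (Pointwise-mono (λ {d} → mapD⇓⁻ f d) (Pointwise-mapTˡ⁻ t p))
          v' , ζt⇓v' , v'≐v = ζ⇓⁺ t⇓v in
      mapT f v' , mapD⇓⁺ (mapT f) (ζ 𝕋 t) ζt⇓v' ,
      ≐-trans (≐-sym (Pointwise-mapTˡ fv≡u)) (Pointwise-mapT (cong f) (≐-sym v'≐v))

    ←values : ∀ {v} → mapD (mapT f) (ζ 𝕋 t) ⇓ v → ∃[ u ] (mapT (mapD f) t ⇓ᵀ u × u ≐ v)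
    ←values q with mapD⇓⁻ (mapT f) (ζ 𝕋 t) q
    ... | v , ζt⇓v , refl = mapT f v , Pointwise-mapT (λ {d} → mapD⇓⁺ f d) (ζ⇓⁻ t ζt⇓v) , ≐-refl _

  ζ-unit-≐ : (s : Term sig A) → Equiconv _≐_ (ζ 𝕋 (mapT now s)) (now s)
  ζ-unit-≐ s = ζ-Equiconv-≐ (mapT now s) (now s)
    (λ p → s , now⇓ , Pointwise-sym (sym ∘ now⇓⁻) (Pointwise-mapTˡ⁻ s p))
    (λ q → s , Pointwise-mapTˡ (Pointwise-mono (λ { refl → now⇓ }) (≐-refl s)) , subst (s ≐_) (now⇓⁻ q) (≐-refl s))

  flatten⇓ᵀ⁻ : (t : Term sig (Term sig (Delay A))) {u : Term sig A} →
    flatten t ⇓ᵀ u → ∃[ v ] (mapT (ζ 𝕋) t ⇓ᵀ v × u ≐ flatten v)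
  flatten⇓ᵀ⁻ (var s) p = let u , ζs⇓u , u≐ = ζ⇓⁺ p in var u , var ζs⇓u , ≐-sym u≐
  flatten⇓ᵀ⁻ (op o ts) (op .o ps) =
    op o (proj₁ ∘ values) , op o (proj₁ ∘ proj₂ ∘ values) , op o (proj₂ ∘ proj₂ ∘ values)
    where values = λ i → flatten⇓ᵀ⁻ (ts i) (ps i)

  ζ-flatten-≐ : (t : Term sig (Term sig (Delay A))) →
    Equiconv _≐_ (ζ 𝕋 (flatten t)) (mapD flatten (ζ 𝕋 (mapT (ζ 𝕋) t)))
  ζ-flatten-≐ t = ζ-Equiconv-≐ (flatten t) (mapD flatten (ζ 𝕋 (mapT (ζ 𝕋) t))) values→ ←values
    where
    values→ : ∀ {u} → flatten t ⇓ᵀ u → ∃[ v ] (mapD flatten (ζ 𝕋 (mapT (ζ 𝕋) t)) ⇓ v × u ≐ v)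
    values→ p =
      let v , ζt⇓ᵀv , u≐ = flatten⇓ᵀ⁻ t p ; v' , ζζt⇓v' , v'≐v = ζ⇓⁺ ζt⇓ᵀv in
      flatten v' , mapD⇓⁺ flatten (ζ 𝕋 (mapT (ζ 𝕋) t)) ζζt⇓v' ,
      ≐-trans u≐ (Pointwise-subst (λ { refl → ≐-refl _ }) (≐-sym v'≐v))

    ←values : ∀ {v} → mapD flatten (ζ 𝕋 (mapT (ζ 𝕋) t)) ⇓ v → ∃[ u ] (flatten t ⇓ᵀ u × u ≐ v)
    ←values q with mapD⇓⁻ flatten (ζ 𝕋 (mapT (ζ 𝕋) t)) q
    ... | v , ζζt⇓v , refl =
      flatten v , Pointwise-subst (λ {s} → ζ⇓⁻ s) (Pointwise-mapTˡ⁻ t (ζ⇓⁻ _ ζζt⇓v)) , ≐-refl _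

  ζ-joinD-≐ : (t : Term sig (Delay (Delay A))) →
    Equiconv _≐_ (ζ 𝕋 (mapT joinD t)) (joinD (mapD (ζ 𝕋) (ζ 𝕋 t)))
  ζ-joinD-≐ t = ζ-Equiconv-≐ (mapT joinD t) (joinD (mapD (ζ 𝕋) (ζ 𝕋 t))) values→ ←values
    where
    values→ : ∀ {u} → mapT joinD t ⇓ᵀ u → ∃[ v ] (joinD (mapD (ζ 𝕋) (ζ 𝕋 t)) ⇓ v × u ≐ v)
    values→ p =
      let v , t⇓ᵀv , v⇓ᵀu = Pointwise-factor (Pointwise-mono (λ {dd} → joinD⇓⁻ dd) (Pointwise-mapTˡ⁻ t p))
          v' , ζt⇓v' , v'≐v = ζ⇓⁺ t⇓ᵀv
          u' , ζv'⇓u' , u'≐u = ζ⇓⁺ (Pointwise-trans (λ { refl q → q }) v'≐v v⇓ᵀu) in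
      u' , joinD⇓⁺ (mapD (ζ 𝕋) (ζ 𝕋 t)) (mapD⇓⁺ (ζ 𝕋) (ζ 𝕋 t) ζt⇓v') ζv'⇓u' , ≐-sym u'≐u

    ←values : ∀ {v} → joinD (mapD (ζ 𝕋) (ζ 𝕋 t)) ⇓ v → ∃[ u ] (mapT joinD t ⇓ᵀ u × u ≐ v)
    ←values q with joinD⇓⁻ (mapD (ζ 𝕋) (ζ 𝕋 t)) q
    ... | d , ζζt⇓d , d⇓v with mapD⇓⁻ (ζ 𝕋) (ζ 𝕋 t) ζζt⇓d
    ...   | v , ζt⇓v , refl =
      _ , Pointwise-mapTˡ (Pointwise-trans (λ {dd} → joinD⇓⁺ dd) (ζ⇓⁻ t ζt⇓v) (ζ⇓⁻ v d⇓v)) , ≐-refl _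

theorem7p7 : (𝕋 : Theory) → NoDropEquations 𝕋 → IsDistributiveLawSd 𝕋
theorem7p7 𝕋 no-drop = record
  { ζ-morphism = λ _ p → Equiconv⇒WB (ζ-preserves-WB no-drop p)
  ; ζ-natural  = λ _ _ f f-cong {_} {t} p → Equiconv⇒WB (Equiconv-TRel-≐
      (Equiconv-mapD (TRel-mapT f f-cong) (ζ-preserves-WB no-drop p)) (ζ-natural-≐ f t))
  ; ζ-unit-T   = λ _ p → Equiconv⇒WB (Equiconv-mapD t-var (WB⇒Equiconv p))
  ; ζ-unit-D   = λ _ {s} p → Equiconv⇒WB (Equiconv-trans (λ q r → t-trans (≐⇒TRel q) r) (ζ-unit-≐ s) (Equiconv-now p))
  ; ζ-mult-T   = λ _ {_} {t} p → Equiconv⇒WB (Equiconv-TRel-≐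
      (ζ-preserves-WB no-drop (TRel-flatten p)) (ζ-flatten-≐ t))
  ; ζ-mult-D   = λ _ {_} {t} p → Equiconv⇒WB (Equiconv-TRel-≐
      (ζ-preserves-WB no-drop (TRel-mapT joinD WB-joinD p)) (ζ-joinD-≐ t))
  }
  where open DistributiveLaw 𝕋
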